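{- Let $n \ge 1$. The map $\psi^+ : \tilde N^+(n) \to \bar N(n)$ defined by $\psi^+(\langle s \rangle) = [\Xi(s)]$ (where $s\in\{0,1\}^n$ is any length-$n$ string representing the necklace) is well defined and is a bijection.
   Context: For $s\in\{0,1\}^n$, $\langle s\rangle$ denotes its necklace, i.e. its orbit under cyclic rotation $L(s_1\cdots s_n)=s_2\cdots s_n s_1$. A string is primitive if $L^k(s)\ne s$ for $1\le k<n$. The inversion $\iota$ swaps $0$ and $1$ in every position. $[s]$ denotes the orbit of $s$ under the group generated by $L$ and $\iota$ (the necklace inversion class). $\bar N(n)$ is the set of classes $[s]$ with $s\in\{0,1\}^n$ primitive. $\tilde N^+(n)$ is the set of necklaces $\langle s\rangle$ of length $n$ such that either $s$ is primitive with an even number of $1$'s, or ($n$ even and) $s = s's'$ where $s'\in\{0,1\}^{n/2}$ is primitive with an odd number of $1$'s (such a necklace is identified with the primitive necklace $\langle s'\rangle$ of length $n/2$). The map $\Xi:\{0,1\}^n\to\{0,1\}^n$ is the mod-2 partial sum map $\Xi(s_1,\ldots,s_n) = (s_1, s_1+s_2, \ldots, s_1+\cdots+s_n)$, all sums mod $2$. -}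

module Defs where

open import Data.Bool using (Bool; true; false; not; _xor_)
open import Data.Nat using (ℕ; zero; suc; _+_; _<_; _≤_; _%_)
open import Data.Vec using (Vec; []; _∷_; _∷ʳ_; _++_; map)
open import Data.Product using (Σ; ∃; _×_; _,_)
open import Data.Sum using (_⊎_)
open import Function using (id)
open import Relation.Binary.PropositionalEquality using (_≡_; _≢_; subst)

Str : ℕ → Set
Str n = Vec Bool n

L : ∀ {n} → Str n → Str n
L []       = []
L (x ∷ xs) = xs ∷ʳ x

L^ : ∀ {n} → ℕ → Str n → Str n
L^ zero    s = s
L^ (suc k) s = L (L^ k s)

ι : ∀ {n} → Str n → Str n
ι = map not

Ξ-acc : ∀ {n} → Bool → Str n → Str n
Ξ-acc a []       = []
Ξ-acc a (x ∷ xs) = (a xor x) ∷ Ξ-acc (a xor x) xs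

Ξ : ∀ {n} → Str n → Str n
Ξ = Ξ-acc false

weight : ∀ {n} → Str n → ℕ
weight []           = 0
weight (true ∷ xs)  = suc (weight xs)
weight (false ∷ xs) = weight xs

EvenWeight OddWeight : ∀ {n} → Str n → Set
EvenWeight s = weight s % 2 ≡ 0
OddWeight  s = weight s % 2 ≡ 1

Primitive : ∀ {n} → Str n → Set
Primitive {n} s = ∀ k → 1 ≤ k → k < n → L^ k s ≢ s

SameNecklace : ∀ {n} → Str n → Str n → Set
SameNecklace s t = ∃ λ k → L^ k s ≡ t

-- same necklace inversion class: t lies in the orbit of s under the group
-- generated by L and ι, whose elements are L^k and ι ∘ L^k
SameClass : ∀ {n} → Str n → Str n → Set
SameClass s t = ∃ λ k → (L^ k s ≡ t) ⊎ (ι (L^ k s) ≡ t)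

InNplus : ∀ {n} → Str n → Set
InNplus {n} s =
  (Primitive s × EvenWeight s)
  ⊎ (Σ ℕ λ m → Σ (m + m ≡ n) λ eq → Σ (Str m) λ s' →
       Primitive s' × OddWeight s' × subst Str eq (s' ++ s') ≡ s)

-- Ξ is a bijection that intertwines rotation with rotation up to inversion on
-- strings of even weight: L (Ξ s) is Ξ (L s) or ι (Ξ (L s)). Flipping the first
-- bit of s inverts Ξ s and changes the parity of s, so for even s and t the
-- strings Ξ s and ι (Ξ t) never coincide. Hence for even s, t we get
-- [Ξ s] = [Ξ t] iff ⟨s⟩ = ⟨t⟩, which is well-definedness and injectivity.
-- For a primitive u, one of u, ι u has an even preimage s. A period k < n of s
-- gives L^k u = ι u, so 2k is a period of u and n = 2k; then s = x x with x
-- primitive, and x has odd weight since otherwise Ξ s = (Ξ x)(Ξ x) and u would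
-- have period n/2. Conversely, if x is odd then Ξ (x x) = w (ι w), whose
-- half-turn is its inversion, so Ξ (x x) is primitive.

module Submission where

open import Defs
open import Data.Bool using (Bool; true; false; not; _xor_)
open import Data.Bool.Properties
  using (_≟_; not-involutive; not-injective; not-¬; ¬-not; not-distribˡ-xor;
         xor-assoc; xor-comm; xor-same; xor-identityʳ)
open import Data.List as List using (List)
import Data.List.Properties as List
open import Data.Nat using (ℕ; zero; suc; _≤_; _+_; _∸_; _<_; _%_; _≤?_; s≤s; z≤n)
open import Data.Nat.DivMod using (%-distribˡ-+)
open import Data.Nat.Properties
  using (<-cmp; <-irrefl; <⇒≤; ≤-trans; <-≤-trans; m≤m+n; m<m+n; +-mono-<;
         ∸-monoˡ-<; m+n∸n≡m; m∸n+n≡m; m<n⇒0<n∸m; anyUpTo?)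
open import Data.Product using (Σ; _×_; _,_; ∃; proj₁)
open import Data.Sum using (_⊎_; inj₁; inj₂)
open import Data.Vec using (Vec; []; _∷_; _∷ʳ_; _++_; toList; splitAt)
open import Data.Vec.Properties
  using (∷-injective; ≡-dec; ++-injectiveˡ; map-++; map-∷ʳ; toList-++; toList-∷ʳ;
         length-toList; toList-injective; cast-is-id)
open import Relation.Binary.Definitions using (tri<; tri≈; tri>)
open import Relation.Binary.PropositionalEquality
open import Relation.Nullary using (yes; no; contradiction)
open import Relation.Nullary.Decidable using (_×-dec_)

private
  variable
    A : Set
    m n k : ℕ
    a b c : Str n

open ≡-Reasoning

xor-cancelˡ : ∀ x y → x xor (x xor y) ≡ y
xor-cancelˡ x y = trans (sym (xor-assoc x x y)) (cong (_xor y) (xor-same x))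

toℕ : Bool → ℕ
toℕ false = 0
toℕ true  = 1

parity : Str n → Bool
parity []       = false
parity (x ∷ xs) = x xor parity xs

weight%2≡parity : (s : Str n) → weight s % 2 ≡ toℕ (parity s)
weight%2≡parity []          = refl
weight%2≡parity (false ∷ s) = weight%2≡parity s
weight%2≡parity (true ∷ s)  = begin
  (1 + weight s) % 2             ≡⟨ %-distribˡ-+ 1 (weight s) 2 ⟩
  (1 + weight s % 2) % 2         ≡⟨ cong (λ r → (1 + r) % 2) (weight%2≡parity s) ⟩
  (1 + toℕ (parity s)) % 2       ≡⟨ suc-toℕ (parity s) ⟩
  toℕ (not (parity s))           ∎
  where
  suc-toℕ : ∀ x → (1 + toℕ x) % 2 ≡ toℕ (not x)
  suc-toℕ false = refl
  suc-toℕ true  = refl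

weight%2⇒parity : ∀ x (s : Str n) → weight s % 2 ≡ toℕ x → parity s ≡ x
weight%2⇒parity x s w = toℕ-injective (parity s) x (trans (sym (weight%2≡parity s)) w)
  where
  toℕ-injective : ∀ x y → toℕ x ≡ toℕ y → x ≡ y
  toℕ-injective false false _ = refl
  toℕ-injective true  true  _ = refl

parity⇒weight%2 : ∀ x (s : Str n) → parity s ≡ x → weight s % 2 ≡ toℕ x
parity⇒weight%2 x s p = trans (weight%2≡parity s) (cong toℕ p)

parity-++ : (x : Str m) (y : Str n) → parity (x ++ y) ≡ parity x xor parity y
parity-++ []      y = refl
parity-++ (z ∷ x) y =
  trans (cong (z xor_) (parity-++ x y)) (sym (xor-assoc z (parity x) (parity y)))

parity-double : (x : Str m) → parity (x ++ x) ≡ false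
parity-double x = trans (parity-++ x x) (xor-same (parity x))

parity-∷ʳ : (xs : Str n) (x : Bool) → parity (xs ∷ʳ x) ≡ x xor parity xs
parity-∷ʳ []       x = refl
parity-∷ʳ (y ∷ xs) x = begin
  y xor parity (xs ∷ʳ x)    ≡⟨ cong (y xor_) (parity-∷ʳ xs x) ⟩
  y xor (x xor parity xs)   ≡⟨ xor-assoc y x (parity xs) ⟨
  (y xor x) xor parity xs   ≡⟨ cong (_xor parity xs) (xor-comm y x) ⟩
  (x xor y) xor parity xs   ≡⟨ xor-assoc x y (parity xs) ⟩
  x xor (y xor parity xs)   ∎

parity-L : (s : Str n) → parity (L s) ≡ parity s
parity-L []       = refl
parity-L (x ∷ xs) = parity-∷ʳ xs x

parity-L^ : ∀ k (s : Str n) → parity (L^ k s) ≡ parity s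
parity-L^ zero    s = refl
parity-L^ (suc k) s = trans (parity-L (L^ k s)) (parity-L^ k s)

-- Rotations are computed on lists, where rotating xs ++ ys by the length of xs
-- needs no cast between Vec A (m + n) and Vec A (n + m).
rotate : List A → List A
rotate List.[]       = List.[]
rotate (x List.∷ xs) = xs List.++ List.[ x ]

rotate^ : ℕ → List A → List A
rotate^ zero    xs = xs
rotate^ (suc k) xs = rotate (rotate^ k xs)

rotate^-suc : ∀ k (xs : List A) → rotate^ (suc k) xs ≡ rotate^ k (rotate xs)
rotate^-suc zero    xs = refl
rotate^-suc (suc k) xs = cong rotate (rotate^-suc k xs)

rotate^-++ : (xs ys : List A) → rotate^ (List.length xs) (xs List.++ ys) ≡ ys List.++ xs
rotate^-++ List.[]       ys = sym (List.++-identityʳ ys)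
rotate^-++ (x List.∷ xs) ys = begin
  rotate^ (suc (List.length xs)) (x List.∷ xs List.++ ys)
    ≡⟨ rotate^-suc (List.length xs) (x List.∷ xs List.++ ys) ⟩
  rotate^ (List.length xs) ((xs List.++ ys) List.++ List.[ x ])
    ≡⟨ cong (rotate^ (List.length xs)) (List.++-assoc xs ys List.[ x ]) ⟩
  rotate^ (List.length xs) (xs List.++ ys List.++ List.[ x ])
    ≡⟨ rotate^-++ xs (ys List.++ List.[ x ]) ⟩
  (ys List.++ List.[ x ]) List.++ xs
    ≡⟨ List.++-assoc ys List.[ x ] xs ⟩
  ys List.++ x List.∷ xs ∎

toList-L^ : ∀ k (s : Str n) → toList (L^ k s) ≡ rotate^ k (toList s)
toList-L^ zero    s = refl
toList-L^ (suc k) s = trans (toList-L (L^ k s)) (cong rotate (toList-L^ k s))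
  where
  toList-L : (s : Str n) → toList (L s) ≡ rotate (toList s)
  toList-L []       = refl
  toList-L (x ∷ xs) = toList-∷ʳ x xs

toList-injective′ : (xs ys : Vec A n) → toList xs ≡ toList ys → xs ≡ ys
toList-injective′ xs ys e = trans (sym (cast-is-id refl xs)) (toList-injective refl xs ys e)

L^-++ : (x y : Str m) → L^ m (x ++ y) ≡ y ++ x
L^-++ {m} x y = toList-injective′ (L^ m (x ++ y)) (y ++ x) (begin
  toList (L^ m (x ++ y))
    ≡⟨ toList-L^ m (x ++ y) ⟩
  rotate^ m (toList (x ++ y))
    ≡⟨ cong₂ rotate^ (sym (length-toList x)) (toList-++ x y) ⟩
  rotate^ (List.length (toList x)) (toList x List.++ toList y)
    ≡⟨ rotate^-++ (toList x) (toList y) ⟩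
  toList y List.++ toList x
    ≡⟨ toList-++ y x ⟨
  toList (y ++ x) ∎)

L^-length : (u : Str n) → L^ n u ≡ u
L^-length {n} u = toList-injective′ (L^ n u) u (begin
  toList (L^ n u)
    ≡⟨ toList-L^ n u ⟩
  rotate^ n (toList u)
    ≡⟨ cong₂ rotate^ (sym (length-toList u)) (sym (List.++-identityʳ (toList u))) ⟩
  rotate^ (List.length (toList u)) (toList u List.++ List.[])
    ≡⟨ rotate^-++ (toList u) List.[] ⟩
  toList u ∎)

L^-+ : ∀ k j (s : Str n) → L^ (k + j) s ≡ L^ k (L^ j s)
L^-+ zero    j s = refl
L^-+ (suc k) j s = cong L (L^-+ k j s)

∷ʳ-++-∷ : ∀ x y (xs : Str m) (ys : Str n) → (xs ++ x ∷ ys) ∷ʳ y ≡ (xs ∷ʳ x) ++ (ys ∷ʳ y)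
∷ʳ-++-∷ x y []       ys = refl
∷ʳ-++-∷ x y (z ∷ xs) ys = cong (z ∷_) (∷ʳ-++-∷ x y xs ys)

L^-double : ∀ k (x : Str m) → L^ k (x ++ x) ≡ L^ k x ++ L^ k x
L^-double zero    x = refl
L^-double (suc k) x = trans (cong L (L^-double k x)) (L-double (L^ k x))
  where
  L-double : (x : Str m) → L (x ++ x) ≡ L x ++ L x
  L-double []      = refl
  L-double (z ∷ x) = ∷ʳ-++-∷ z z x x

ι-involutive : (u : Str n) → ι (ι u) ≡ u
ι-involutive []      = refl
ι-involutive (x ∷ u) = cong₂ _∷_ (not-involutive x) (ι-involutive u)

ι-no-fixpoint : 1 ≤ n → (u : Str n) → ι u ≢ u
ι-no-fixpoint (s≤s z≤n) (x ∷ u) e = not-¬ refl (sym (proj₁ (∷-injective e)))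

L^-ι : ∀ k (u : Str n) → L^ k (ι u) ≡ ι (L^ k u)
L^-ι zero    u = refl
L^-ι (suc k) u = trans (cong L (L^-ι k u)) (L-ι (L^ k u))
  where
  L-ι : (u : Str n) → L (ι u) ≡ ι (L u)
  L-ι []       = refl
  L-ι (x ∷ xs) = sym (map-∷ʳ not x xs)

antiperiod-double : ∀ k (u : Str n) → ι (L^ k u) ≡ u → L^ (k + k) u ≡ u
antiperiod-double k u e = begin
  L^ (k + k) u    ≡⟨ L^-+ k k u ⟩
  L^ k (L^ k u)   ≡⟨ cong (L^ k) (trans (sym (ι-involutive (L^ k u))) (cong ι e)) ⟩
  L^ k (ι u)      ≡⟨ L^-ι k u ⟩
  ι (L^ k u)      ≡⟨ e ⟩
  u               ∎

primitive-period : (u : Str n) → Primitive u → 1 ≤ k → k < n + n → L^ k u ≡ u → k ≡ n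
primitive-period {n} {k} u prim 1≤k k<2n Lᵏu≡u with <-cmp k n
... | tri< k<n _ _ = contradiction Lᵏu≡u (prim k 1≤k k<n)
... | tri≈ _ k≡n _ = k≡n
... | tri> _ _ n<k = contradiction Lʲu≡u (prim j (m<n⇒0<n∸m n<k) j<n)
  where
  j = k ∸ n
  j<n : j < n
  j<n = subst (j <_) (m+n∸n≡m n n) (∸-monoˡ-< k<2n (<⇒≤ n<k))
  Lʲu≡u : L^ j u ≡ u
  Lʲu≡u = begin
    L^ j u          ≡⟨ cong (L^ j) (L^-length u) ⟨
    L^ j (L^ n u)   ≡⟨ L^-+ j n u ⟨
    L^ (j + n) u    ≡⟨ cong (λ i → L^ i u) (m∸n+n≡m (<⇒≤ n<k)) ⟩
    L^ k u          ≡⟨ Lᵏu≡u ⟩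
    u               ∎

double-period : (x : Str m) → Primitive x → 1 ≤ k → k < m + m →
                L^ k (x ++ x) ≡ x ++ x → k ≡ m
double-period {k = k} x prim 1≤k k<2m e = primitive-period x prim 1≤k k<2m
  (++-injectiveˡ (L^ k x) x (trans (sym (L^-double k x)) e))

half-period⇒double : (s : Str (m + m)) → L^ m s ≡ s → ∃ λ x → x ++ x ≡ s
half-period⇒double {m} s e with splitAt m s
... | x , y , refl = x , cong (x ++_) (sym (++-injectiveˡ y x (trans (sym (L^-++ x y)) e)))

-- SameClass a b unfolds to ∃ λ k → L^ k a ≡ι b.
infix 4 _≡ι_
_≡ι_ : Str n → Str n → Set
a ≡ι b = a ≡ b ⊎ ι a ≡ b

≡ι-sym : a ≡ι b → b ≡ι a
≡ι-sym         (inj₁ refl) = inj₁ refl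
≡ι-sym {a = a} (inj₂ refl) = inj₂ (ι-involutive a)

≡ι-trans : a ≡ι b → b ≡ι c → a ≡ι c
≡ι-trans         (inj₁ refl) q           = q
≡ι-trans         (inj₂ refl) (inj₁ refl) = inj₂ refl
≡ι-trans {a = a} (inj₂ refl) (inj₂ refl) = inj₁ (sym (ι-involutive a))

L^-≡ι : ∀ k → a ≡ι b → L^ k a ≡ι L^ k b
L^-≡ι k         (inj₁ refl) = inj₁ refl
L^-≡ι {a = a} k (inj₂ refl) = inj₂ (sym (L^-ι k a))

≡ι-period : ∀ k → a ≡ι b → L^ k a ≡ a → L^ k b ≡ b
≡ι-period         k (inj₁ refl) e = e
≡ι-period {a = a} k (inj₂ refl) e = trans (L^-ι k a) (cong ι e)

Ξ-acc-not : ∀ x (s : Str n) → Ξ-acc (not x) s ≡ ι (Ξ-acc x s)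
Ξ-acc-not x []      = refl
Ξ-acc-not x (y ∷ s) = begin
  (not x xor y) ∷ Ξ-acc (not x xor y) s       ≡⟨ cong (λ z → z ∷ Ξ-acc z s) (not-distribˡ-xor x y) ⟨
  not (x xor y) ∷ Ξ-acc (not (x xor y)) s     ≡⟨ cong (not (x xor y) ∷_) (Ξ-acc-not (x xor y) s) ⟩
  ι (Ξ-acc x (y ∷ s))                         ∎

ι-Ξ : ∀ x (xs : Str n) → ι (Ξ (x ∷ xs)) ≡ Ξ (not x ∷ xs)
ι-Ξ x xs = cong (not x ∷_) (sym (Ξ-acc-not x xs))

Ξ-acc-++ : ∀ x (y : Str m) (z : Str n) →
           Ξ-acc x (y ++ z) ≡ Ξ-acc x y ++ Ξ-acc (x xor parity y) z
Ξ-acc-++ x []      z = cong (λ w → Ξ-acc w z) (sym (xor-identityʳ x))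
Ξ-acc-++ x (w ∷ y) z = cong ((x xor w) ∷_) (begin
  Ξ-acc (x xor w) (y ++ z)
    ≡⟨ Ξ-acc-++ (x xor w) y z ⟩
  Ξ-acc (x xor w) y ++ Ξ-acc ((x xor w) xor parity y) z
    ≡⟨ cong (λ v → Ξ-acc (x xor w) y ++ Ξ-acc v z) (xor-assoc x w (parity y)) ⟩
  Ξ-acc (x xor w) y ++ Ξ-acc (x xor (w xor parity y)) z ∎)

Ξ-acc-∷ʳ : ∀ x (ys : Str n) y → Ξ-acc x (ys ∷ʳ y) ≡ Ξ-acc x ys ∷ʳ (x xor (parity ys xor y))
Ξ-acc-∷ʳ x []       y = refl
Ξ-acc-∷ʳ x (z ∷ ys) y = cong ((x xor z) ∷_) (begin
  Ξ-acc (x xor z) (ys ∷ʳ y)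
    ≡⟨ Ξ-acc-∷ʳ (x xor z) ys y ⟩
  Ξ-acc (x xor z) ys ∷ʳ ((x xor z) xor (parity ys xor y))
    ≡⟨ cong (Ξ-acc (x xor z) ys ∷ʳ_) (xor-assoc x z (parity ys xor y)) ⟩
  Ξ-acc (x xor z) ys ∷ʳ (x xor (z xor (parity ys xor y)))
    ≡⟨ cong (λ v → Ξ-acc (x xor z) ys ∷ʳ (x xor v)) (xor-assoc z (parity ys) y) ⟨
  Ξ-acc (x xor z) ys ∷ʳ (x xor ((z xor parity ys) xor y)) ∎)

Ξ-acc-injective : ∀ x (s t : Str n) → Ξ-acc x s ≡ Ξ-acc x t → s ≡ t
Ξ-acc-injective x []      []      e = refl
Ξ-acc-injective x (y ∷ s) (z ∷ t) e with ∷-injective e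
... | x⊕y≡x⊕z , Ξs≡Ξt = cong₂ _∷_ y≡z
  (Ξ-acc-injective (x xor y) s t (trans Ξs≡Ξt (cong (λ w → Ξ-acc w t) (sym x⊕y≡x⊕z))))
  where
  y≡z : y ≡ z
  y≡z = trans (sym (xor-cancelˡ x y)) (trans (cong (x xor_) x⊕y≡x⊕z) (xor-cancelˡ x z))

Ξ-acc-surjective : ∀ x (v : Str n) → ∃ λ s → Ξ-acc x s ≡ v
Ξ-acc-surjective x []      = [] , refl
Ξ-acc-surjective x (y ∷ v) with Ξ-acc-surjective y v
... | s , Ξs≡v = (x xor y) ∷ s ,
  cong₂ _∷_ (xor-cancelˡ x y) (trans (cong (λ w → Ξ-acc w s) (xor-cancelˡ x y)) Ξs≡v)

L-Ξ : (s : Str n) → parity s ≡ false → L (Ξ s) ≡ι Ξ (L s)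
L-Ξ []           _ = inj₁ refl
L-Ξ (false ∷ xs) p =
  inj₁ (sym (trans (Ξ-acc-∷ʳ false xs false) (cong (λ x → Ξ xs ∷ʳ (x xor false)) p)))
L-Ξ (true ∷ xs)  p = inj₂ (begin
  ι (Ξ-acc true xs ∷ʳ true)       ≡⟨ map-∷ʳ not true (Ξ-acc true xs) ⟩
  ι (Ξ-acc true xs) ∷ʳ false      ≡⟨ cong (λ v → ι v ∷ʳ false) (Ξ-acc-not false xs) ⟩
  ι (ι (Ξ xs)) ∷ʳ false           ≡⟨ cong (_∷ʳ false) (ι-involutive (Ξ xs)) ⟩
  Ξ xs ∷ʳ false                   ≡⟨ cong (λ x → Ξ xs ∷ʳ (x xor true)) (not-injective {y = true} p) ⟨
  Ξ xs ∷ʳ (parity xs xor true)    ≡⟨ Ξ-acc-∷ʳ false xs true ⟨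
  Ξ (xs ∷ʳ true)                  ∎)

L^-Ξ : ∀ k (s : Str n) → parity s ≡ false → L^ k (Ξ s) ≡ι Ξ (L^ k s)
L^-Ξ zero    s p = inj₁ refl
L^-Ξ (suc k) s p = ≡ι-trans (L^-≡ι 1 (L^-Ξ k s p)) (L-Ξ (L^ k s) (trans (parity-L^ k s) p))

Ξ-≡ι-injective : (s t : Str n) → parity s ≡ false → parity t ≡ false → Ξ s ≡ι Ξ t → s ≡ t
Ξ-≡ι-injective s        t        _  _  (inj₁ e) = Ξ-acc-injective false s t e
Ξ-≡ι-injective []       []       _  _  (inj₂ _) = refl
Ξ-≡ι-injective (x ∷ xs) t        ps pt (inj₂ e) = contradiction (begin
  true                     ≡⟨ cong not ps ⟨
  not (x xor parity xs)    ≡⟨ not-distribˡ-xor x (parity xs) ⟩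
  parity (not x ∷ xs)      ≡⟨ cong parity (Ξ-acc-injective false (not x ∷ xs) t (trans (sym (ι-Ξ x xs)) e)) ⟩
  parity t                 ≡⟨ pt ⟩
  false                    ∎) λ ()

Ξ-period : ∀ k (s : Str n) → parity s ≡ false → L^ k (Ξ s) ≡ Ξ s → L^ k s ≡ s
Ξ-period k s p e = Ξ-≡ι-injective (L^ k s) s (trans (parity-L^ k s) p) p
  (≡ι-trans (≡ι-sym (L^-Ξ k s p)) (inj₁ e))

L^-Ξ-even-double : (x : Str m) → parity x ≡ false → L^ m (Ξ (x ++ x)) ≡ Ξ (x ++ x)
L^-Ξ-even-double {m} x p = begin
  L^ m (Ξ (x ++ x))   ≡⟨ cong (L^ m) Ξxx ⟩
  L^ m (Ξ x ++ Ξ x)   ≡⟨ L^-++ (Ξ x) (Ξ x) ⟩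
  Ξ x ++ Ξ x          ≡⟨ Ξxx ⟨
  Ξ (x ++ x)          ∎
  where
  Ξxx : Ξ (x ++ x) ≡ Ξ x ++ Ξ x
  Ξxx = trans (Ξ-acc-++ false x x) (cong (λ y → Ξ x ++ Ξ-acc y x) p)

L^-Ξ-odd-double : (x : Str m) → parity x ≡ true → L^ m (Ξ (x ++ x)) ≡ ι (Ξ (x ++ x))
L^-Ξ-odd-double {m} x p = begin
  L^ m (Ξ (x ++ x))          ≡⟨ cong (L^ m) Ξxx ⟩
  L^ m (Ξ x ++ ι (Ξ x))      ≡⟨ L^-++ (Ξ x) (ι (Ξ x)) ⟩
  ι (Ξ x) ++ Ξ x             ≡⟨ cong (ι (Ξ x) ++_) (ι-involutive (Ξ x)) ⟨
  ι (Ξ x) ++ ι (ι (Ξ x))     ≡⟨ map-++ not (Ξ x) (ι (Ξ x)) ⟨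
  ι (Ξ x ++ ι (Ξ x))         ≡⟨ cong ι Ξxx ⟨
  ι (Ξ (x ++ x))             ∎
  where
  Ξxx : Ξ (x ++ x) ≡ Ξ x ++ ι (Ξ x)
  Ξxx = trans (Ξ-acc-++ false x x)
              (trans (cong (λ y → Ξ x ++ Ξ-acc y x) p) (cong (Ξ x ++_) (Ξ-acc-not false x)))

InNplus-parity : (s : Str n) → InNplus s → parity s ≡ false
InNplus-parity s (inj₁ (_ , even))                  = weight%2⇒parity false s even
InNplus-parity _ (inj₂ (_ , refl , x , _ , _ , refl)) = parity-double x

even-Ξ-preimage : (u : Str (suc n)) → ∃ λ s → parity s ≡ false × Ξ s ≡ι u
even-Ξ-preimage u with Ξ-acc-surjective false u
... | x ∷ xs , Ξs≡u with parity (x ∷ xs) in p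
...   | false = x ∷ xs , p , inj₁ Ξs≡u
...   | true  = not x ∷ xs ,
  trans (sym (not-distribˡ-xor x (parity xs))) (cong not p) ,
  inj₂ (trans (cong ι (sym (ι-Ξ x xs))) (trans (ι-involutive (Ξ (x ∷ xs))) Ξs≡u))

period-≡ι : ∀ k (s : Str n) → parity s ≡ false → Ξ s ≡ι b → L^ k s ≡ s → L^ k b ≡ι b
period-≡ι k s p tw e = ≡ι-trans (≡ι-sym (L^-≡ι k tw))
  (≡ι-trans (subst (λ v → L^ k (Ξ s) ≡ι Ξ v) e (L^-Ξ k s p)) tw)

period-is-half : (u s : Str n) → Primitive u → parity s ≡ false → Ξ s ≡ι u →
                 1 ≤ k → k < n → L^ k s ≡ s → k + k ≡ n
period-is-half {k = k} u s prim p tw 1≤k k<n e with period-≡ι k s p tw e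
... | inj₁ Lᵏu≡u  = contradiction Lᵏu≡u (prim k 1≤k k<n)
... | inj₂ ιLᵏu≡u = primitive-period u prim (≤-trans 1≤k (m≤m+n k k)) (+-mono-< k<n k<n)
                      (antiperiod-double k u ιLᵏu≡u)

double-preimage-InNplus : (u : Str (m + m)) → Primitive u → (x : Str m) →
                          Ξ (x ++ x) ≡ι u → 1 ≤ m → InNplus (x ++ x)
double-preimage-InNplus {m} u prim x tw 1≤m = inj₂ (m , refl , x , x-primitive , x-odd , refl)
  where
  x-primitive : Primitive x
  x-primitive j 1≤j j<m Lʲx≡x = <-irrefl
    (period-is-half u (x ++ x) prim (parity-double x) tw 1≤j (<-≤-trans j<m (m≤m+n m m))
      (trans (L^-double j x) (cong₂ _++_ Lʲx≡x Lʲx≡x)))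
    (+-mono-< j<m j<m)
  x-odd : OddWeight x
  x-odd = parity⇒weight%2 true x (¬-not λ even →
    prim m 1≤m (m<m+n m 1≤m) (≡ι-period m tw (L^-Ξ-even-double x even)))

even-preimage-InNplus : (u : Str n) → Primitive u → (s : Str n) →
                        parity s ≡ false → Ξ s ≡ι u → InNplus s
even-preimage-InNplus {n} u prim s p tw
  with anyUpTo? (λ k → 1 ≤? k ×-dec ≡-dec _≟_ (L^ k s) s) n
... | no aperiodic =
  inj₁ ((λ k 1≤k k<n e → aperiodic (k , k<n , 1≤k , e)) , parity⇒weight%2 false s p)
... | yes (k , k<n , 1≤k , e) with period-is-half u s prim p tw 1≤k k<n e
...   | refl with half-period⇒double {k} s e
...     | x , refl = double-preimage-InNplus u prim x tw 1≤k

ψ⁺-wellDefined : (s t : Str n) → InNplus s → SameNecklace s t → SameClass (Ξ s) (Ξ t)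
ψ⁺-wellDefined s _ s∈N⁺ (k , refl) = k , L^-Ξ k s (InNplus-parity s s∈N⁺)

ψ⁺-primitive : 1 ≤ n → (s : Str n) → InNplus s → Primitive (Ξ s)
ψ⁺-primitive 1≤n s s∈N⁺ k 1≤k k<n e with s∈N⁺
... | inj₁ (prim , _) = prim k 1≤k k<n (Ξ-period k s (InNplus-parity s s∈N⁺) e)
... | inj₂ (m , refl , x , prim , odd , refl)
  with double-period x prim 1≤k k<n (Ξ-period k (x ++ x) (parity-double x) e)
...   | refl = ι-no-fixpoint 1≤n (Ξ (x ++ x))
                (trans (sym (L^-Ξ-odd-double x (weight%2⇒parity true x odd))) e)

ψ⁺-injective : (s t : Str n) → InNplus s → InNplus t → SameClass (Ξ s) (Ξ t) → SameNecklace s t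
ψ⁺-injective s t s∈N⁺ t∈N⁺ (k , c) =
  k , Ξ-≡ι-injective (L^ k s) t (trans (parity-L^ k s) ps) (InNplus-parity t t∈N⁺)
        (≡ι-trans (≡ι-sym (L^-Ξ k s ps)) c)
  where
  ps = InNplus-parity s s∈N⁺

ψ⁺-surjective : 1 ≤ n → (u : Str n) → Primitive u → Σ (Str n) λ s → InNplus s × SameClass (Ξ s) u
ψ⁺-surjective (s≤s z≤n) u prim with even-Ξ-preimage u
... | s , p , tw = s , even-preimage-InNplus u prim s p tw , 0 , tw

theoremB : (n : ℕ) → 1 ≤ n →
    -- ψ⁺ is well defined: independent of the representative, lands in N̄(n)
    ((s t : Str n) → InNplus s → SameNecklace s t → SameClass (Ξ s) (Ξ t))
    × ((s : Str n) → InNplus s → Primitive (Ξ s))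
    -- injective
    × ((s t : Str n) → InNplus s → InNplus t → SameClass (Ξ s) (Ξ t) → SameNecklace s t)
    -- surjective
    × ((u : Str n) → Primitive u → Σ (Str n) λ s → InNplus s × SameClass (Ξ s) u)
theoremB n 1≤n = ψ⁺-wellDefined , ψ⁺-primitive 1≤n , ψ⁺-injective , ψ⁺-surjective 1≤n
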